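{- For every $n\ge 0$ and every $k\ge 0$, the number of Motzkin paths of length $n$ containing exactly $k$ occurrences of $UU$ equals the number of Motzkin paths of length $n$ containing exactly $k$ occurrences of $DU$. In particular, $|\mathcal M_n(UU)|=|\mathcal M_n(DU)|$.
   Context: A Motzkin path of length $n$ is a lattice path from $(0,0)$ to $(n,0)$ with steps $U=(1,1)$ (upstep), $F=(1,0)$ (flatstep), $D=(1,-1)$ (downstep) that never goes below the $x$-axis; it is viewed as a word in $U,F,D$. An occurrence of a word $w$ (such as $UU$ or $DU$) in a path is a position where $w$ appears as a block of consecutive steps. $\mathcal M_n$ denotes the set of Motzkin paths of length $n$, and $\mathcal M_n(w_1,\dots,w_r)$ denotes the set of those containing no occurrence of any of $w_1,\dots,w_r$. -}

module Defs where

open import Data.Nat using (ℕ; zero; suc; _+_)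
open import Data.Bool using (Bool; true; false; _∧_)
open import Data.List using (List; []; _∷_; length; filter; concatMap; map)
open import Relation.Binary.PropositionalEquality using (_≡_)
open import Relation.Nullary using (Dec; yes; no)
import Data.Nat as ℕ

-- Steps of a Motzkin path: U = (1,1), F = (1,0), D = (1,-1).
data Step : Set where
  U F D : Step

Word : Set
Word = List Step

words : ℕ → List Word
words zero = [] ∷ []
words (suc n) = concatMap (λ w → (U ∷ w) ∷ (F ∷ w) ∷ (D ∷ w) ∷ []) (words n)

isMotzkinFrom : ℕ → Word → Bool
isMotzkinFrom zero [] = true
isMotzkinFrom (suc _) [] = false
isMotzkinFrom h (U ∷ w) = isMotzkinFrom (suc h) w
isMotzkinFrom h (F ∷ w) = isMotzkinFrom h w
isMotzkinFrom zero (D ∷ w) = false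
isMotzkinFrom (suc h) (D ∷ w) = isMotzkinFrom h w

isMotzkin : Word → Bool
isMotzkin = isMotzkinFrom zero

motzkinPaths : ℕ → List Word
motzkinPaths n = filter (λ w → isMotzkin w Data.Bool.≟ true) (words n)

countUU : Word → ℕ
countUU (U ∷ U ∷ w) = suc (countUU (U ∷ w))
countUU (_ ∷ w) = countUU w
countUU [] = 0

countDU : Word → ℕ
countDU (D ∷ U ∷ w) = suc (countDU (U ∷ w))
countDU (_ ∷ w) = countDU w
countDU [] = 0

numUU : ℕ → ℕ → ℕ
numUU n k = length (filter (λ w → countUU w ℕ.≟ k) (motzkinPaths n))

numDU : ℕ → ℕ → ℕ
numDU n k = length (filter (λ w → countDU w ℕ.≟ k) (motzkinPaths n))

avoidUU : ℕ → ℕ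
avoidUU n = numUU n 0

avoidDU : ℕ → ℕ
avoidDU n = numDU n 0

-- A Motzkin path factors uniquely as empty, F M, or U M D M, so Motzkin paths are
-- trees; mirroring a tree swaps the two subpaths of every factor U a D b.  In U a D b
-- the UU's are those of a and b plus one if a starts with U, while the DU's are
-- those of a and b plus one if b starts with U; mirroring therefore trades UU's for
-- DU's and preserves length.  Extended by the identity off Motzkin paths, it is a
-- length-preserving involution of all words, hence permutes the words of length n.
module Submission where

open import Defs
open import Data.Bool using (true; false; if_then_else_)
open import Data.List using (List; []; _∷_; _++_; length; filter; map; foldr; concatMap)
open import Data.List.Properties using (≡-dec; ++-assoc; ++-identityʳ; length-map; filter-≐)
open import Data.List.Membership.Propositional using (_∈_)
open import Data.List.Membership.Propositional.Properties using (∈-∃++)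
open import Data.List.Relation.Unary.Any using (here; there)
open import Data.List.Relation.Binary.Permutation.Propositional using (_↭_; ↭-sym; ↭-trans; prep)
open import Data.List.Relation.Binary.Permutation.Propositional.Properties
  using (↭-length; filter-↭; shift; ++⁺; ++-comm)
open import Data.Nat using (ℕ; zero; suc; _+_)
open import Data.Nat.Properties using (+-comm; +-assoc; suc-injective)
open import Data.Product using (_×_; _,_; proj₁; ∃₂)
open import Function using (_∘_)
open import Level using (0ℓ)
open import Relation.Binary.Definitions using (DecidableEquality)
open import Relation.Binary.PropositionalEquality
  using (_≡_; refl; sym; trans; cong; cong₂; subst; module ≡-Reasoning)
open import Relation.Nullary using (yes; no; does; contradiction)
open import Relation.Unary using (Pred; Decidable; _≐_)
open import Relation.Unary.Properties using (_∩?_)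
import Data.Bool as Bool
import Data.Nat as ℕ

open ≡-Reasoning

module _ {A : Set} where

  filter-filter : ∀ {P Q : Pred A 0ℓ} (P? : Decidable P) (Q? : Decidable Q) xs →
                  filter Q? (filter P? xs) ≡ filter (P? ∩? Q?) xs
  filter-filter P? Q? [] = refl
  filter-filter P? Q? (x ∷ xs) with does (P? x)
  ... | false = filter-filter P? Q? xs
  ... | true with does (Q? x)
  ...   | true  = cong (x ∷_) (filter-filter P? Q? xs)
  ...   | false = filter-filter P? Q? xs

  filter-map : ∀ {B : Set} {P : Pred B 0ℓ} (P? : Decidable P) (f : A → B) xs →
               filter P? (map f xs) ≡ map f (filter (P? ∘ f) xs)
  filter-map P? f [] = refl
  filter-map P? f (x ∷ xs) with does (P? (f x))
  ... | true  = cong (f x ∷_) (filter-map P? f xs)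
  ... | false = filter-map P? f xs

  length-filter-map : ∀ {B : Set} {P : Pred B 0ℓ} (P? : Decidable P) (f : A → B) xs →
                      length (filter P? (map f xs)) ≡ length (filter (P? ∘ f) xs)
  length-filter-map P? f xs =
    trans (cong length (filter-map P? f xs)) (length-map f (filter (P? ∘ f) xs))

  length-filter-∘ : ∀ {P : Pred A 0ℓ} (P? : Decidable P) (f : A → A) xs → map f xs ↭ xs →
                    length (filter P? xs) ≡ length (filter (P? ∘ f) xs)
  length-filter-∘ P? f xs fxs↭xs =
    trans (↭-length (filter-↭ P? (↭-sym fxs↭xs))) (length-filter-map P? f xs)

module Multiplicity {A : Set} (_≟_ : DecidableEquality A) where

  multiplicity : A → List A → ℕ
  multiplicity x xs = length (filter (x ≟_) xs)

  multiplicity-here : ∀ x xs → multiplicity x (x ∷ xs) ≡ suc (multiplicity x xs)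
  multiplicity-here x xs with x ≟ x
  ... | yes _  = refl
  ... | no x≢x = contradiction refl x≢x

  multiplicity-↭ : ∀ x {xs ys} → xs ↭ ys → multiplicity x xs ≡ multiplicity x ys
  multiplicity-↭ x xs↭ys = ↭-length (filter-↭ (x ≟_) xs↭ys)

  multiplicity-∷-cancel : ∀ {x xs ys} → (∀ z → multiplicity z (x ∷ xs) ≡ multiplicity z (x ∷ ys)) →
                          ∀ z → multiplicity z xs ≡ multiplicity z ys
  multiplicity-∷-cancel {x} same z with z ≟ x | same z
  ... | yes _ | e = suc-injective e
  ... | no _  | e = e

  ∈-of-multiplicity : ∀ x ys {m} → multiplicity x ys ≡ suc m → x ∈ ys
  ∈-of-multiplicity x (y ∷ ys) e with x ≟ y
  ... | yes refl = here refl
  ... | no _     = there (∈-of-multiplicity x ys e)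

  multiplicity-map-involutive : ∀ (f : A → A) → (∀ x → f (f x) ≡ x) →
                                ∀ y xs → multiplicity y (map f xs) ≡ multiplicity (f y) xs
  multiplicity-map-involutive f inv y xs = begin
    length (filter (y ≟_) (map f xs))  ≡⟨ length-filter-map (y ≟_) f xs ⟩
    length (filter ((y ≟_) ∘ f) xs)    ≡⟨ cong length (filter-≐ _ (f y ≟_) swap-sides xs) ⟩
    length (filter (f y ≟_) xs)        ∎
    where
    swap-sides : (λ x → y ≡ f x) ≐ (λ x → f y ≡ x)
    swap-sides = (λ {x} y≡fx → trans (cong f y≡fx) (inv x)) , (λ {x} fy≡x → trans (sym (inv y)) (cong f fy≡x))

  ↭-of-multiplicities : ∀ xs ys → (∀ z → multiplicity z xs ≡ multiplicity z ys) → xs ↭ ys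
  ↭-of-multiplicities [] [] _ = _↭_.refl
  ↭-of-multiplicities [] (y ∷ ys) same with () ← trans (same y) (multiplicity-here y ys)
  ↭-of-multiplicities (x ∷ xs) ys same
    with l , r , refl ← ∈-∃++ (∈-of-multiplicity x ys (trans (sym (same x)) (multiplicity-here x xs))) =
    ↭-trans (prep x (↭-of-multiplicities xs (l ++ r) (multiplicity-∷-cancel same′))) (↭-sym (shift x l r))
    where
    same′ : ∀ z → multiplicity z (x ∷ xs) ≡ multiplicity z (x ∷ l ++ r)
    same′ z = trans (same z) (multiplicity-↭ z (shift x l r))

_≟ₛ_ : DecidableEquality Step
U ≟ₛ U = yes refl
F ≟ₛ F = yes refl
D ≟ₛ D = yes refl
U ≟ₛ F = no λ ()
U ≟ₛ D = no λ ()
F ≟ₛ U = no λ ()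
F ≟ₛ D = no λ ()
D ≟ₛ U = no λ ()
D ≟ₛ F = no λ ()

open Multiplicity (≡-dec _≟ₛ_)

multiplicity-extensions : ∀ s w vs →
  multiplicity (s ∷ w) (concatMap (λ v → (U ∷ v) ∷ (F ∷ v) ∷ (D ∷ v) ∷ []) vs) ≡ multiplicity w vs
multiplicity-extensions s w [] = refl
multiplicity-extensions U w (v ∷ vs) with ≡-dec _≟ₛ_ w v
... | yes _ = cong suc (multiplicity-extensions U w vs)
... | no _  = multiplicity-extensions U w vs
multiplicity-extensions F w (v ∷ vs) with ≡-dec _≟ₛ_ w v
... | yes _ = cong suc (multiplicity-extensions F w vs)
... | no _  = multiplicity-extensions F w vs
multiplicity-extensions D w (v ∷ vs) with ≡-dec _≟ₛ_ w v
... | yes _ = cong suc (multiplicity-extensions D w vs)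
... | no _  = multiplicity-extensions D w vs

multiplicity-words : ∀ n {w w′} → length w ≡ length w′ → multiplicity w (words n) ≡ multiplicity w′ (words n)
multiplicity-words zero    {[]}    {[]}     _ = refl
multiplicity-words zero    {_ ∷ _} {_ ∷ _}  _ = refl
multiplicity-words (suc n) {[]}    {[]}     _ = refl
multiplicity-words (suc n) {s ∷ w} {s′ ∷ w′} e = begin
  multiplicity (s ∷ w) (words (suc n))    ≡⟨ multiplicity-extensions s w (words n) ⟩
  multiplicity w (words n)                ≡⟨ multiplicity-words n (suc-injective e) ⟩
  multiplicity w′ (words n)               ≡⟨ multiplicity-extensions s′ w′ (words n) ⟨
  multiplicity (s′ ∷ w′) (words (suc n))  ∎

data Tree : Set where
  leaf : Tree
  flat : Tree → Tree
  arch : Tree → Tree → Tree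

path : Tree → Word
path leaf       = []
path (flat t)   = F ∷ path t
path (arch a b) = U ∷ path a ++ D ∷ path b

mirror : Tree → Tree
mirror leaf       = leaf
mirror (flat t)   = flat (mirror t)
mirror (arch a b) = arch (mirror b) (mirror a)

mirror-involutive : ∀ t → mirror (mirror t) ≡ t
mirror-involutive leaf       = refl
mirror-involutive (flat t)   = cong flat (mirror-involutive t)
mirror-involutive (arch a b) = cong₂ arch (mirror-involutive a) (mirror-involutive b)

path-mirror-↭ : ∀ t → path (mirror t) ↭ path t
path-mirror-↭ leaf       = _↭_.refl
path-mirror-↭ (flat t)   = prep F (path-mirror-↭ t)
path-mirror-↭ (arch a b) = prep U (↭-trans (++⁺ (path-mirror-↭ b) (prep D (path-mirror-↭ a)))
                                  (↭-trans (++-comm (path b) (D ∷ path a)) (↭-sym (shift D (path a) (path b)))))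

isMotzkinFrom-U : ∀ h w → isMotzkinFrom h (U ∷ w) ≡ isMotzkinFrom (suc h) w
isMotzkinFrom-U zero    w = refl
isMotzkinFrom-U (suc h) w = refl

isMotzkinFrom-F : ∀ h w → isMotzkinFrom h (F ∷ w) ≡ isMotzkinFrom h w
isMotzkinFrom-F zero    w = refl
isMotzkinFrom-F (suc h) w = refl

isMotzkinFrom-path : ∀ h t r → isMotzkinFrom h (path t ++ r) ≡ isMotzkinFrom h r
isMotzkinFrom-path h leaf       r = refl
isMotzkinFrom-path h (flat t)   r = trans (isMotzkinFrom-F h (path t ++ r)) (isMotzkinFrom-path h t r)
isMotzkinFrom-path h (arch a b) r = begin
  isMotzkinFrom h (U ∷ (path a ++ D ∷ path b) ++ r)   ≡⟨ isMotzkinFrom-U h _ ⟩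
  isMotzkinFrom (suc h) ((path a ++ D ∷ path b) ++ r) ≡⟨ cong (isMotzkinFrom (suc h)) (++-assoc (path a) (D ∷ path b) r) ⟩
  isMotzkinFrom (suc h) (path a ++ D ∷ path b ++ r)   ≡⟨ isMotzkinFrom-path (suc h) a (D ∷ path b ++ r) ⟩
  isMotzkinFrom h (path b ++ r)                       ≡⟨ isMotzkinFrom-path h b r ⟩
  isMotzkinFrom h r                                   ∎

isMotzkin-path : ∀ t → isMotzkin (path t) ≡ true
isMotzkin-path t = trans (cong isMotzkin (sym (++-identityʳ (path t)))) (isMotzkinFrom-path 0 t [])

closing : List Tree → Word
closing []      = []
closing (t ∷ s) = D ∷ path t ++ closing s

decompose : ∀ h w → isMotzkinFrom h w ≡ true →
            ∃₂ λ t s → length s ≡ h × w ≡ path t ++ closing s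
decompose zero    []      _ = leaf , [] , refl , refl
decompose (suc h) []      ()
decompose zero    (D ∷ w) ()
decompose (suc h) (D ∷ w) m with t , s , refl , refl ← decompose h w m = leaf , t ∷ s , refl , refl
decompose h       (F ∷ w) m with t , s , refl , refl ← decompose h w (trans (sym (isMotzkinFrom-F h w)) m)
  = flat t , s , refl , refl
decompose h       (U ∷ w) m with t , b ∷ s , e , refl ← decompose (suc h) w (trans (sym (isMotzkinFrom-U h w)) m)
  = arch t b , s , suc-injective e , cong (U ∷_) (sym (++-assoc (path t) (D ∷ path b) (closing s)))

data MotzkinView : Word → Set where
  motzkin    : ∀ t → MotzkinView (path t)
  nonMotzkin : ∀ {w} → isMotzkin w ≡ false → MotzkinView w

motzkinView : ∀ w → MotzkinView w
motzkinView w with isMotzkin w in m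
... | false = nonMotzkin m
... | true with t , [] , _ , refl ← decompose 0 w m = subst MotzkinView (sym (++-identityʳ (path t))) (motzkin t)

-- Reads a word right to left, keeping the tree under construction and a stack of
-- trees already closed by a D; the last clause is never reached on Motzkin words.
parseStep : Step → Tree × List Tree → Tree × List Tree
parseStep F (t , s)     = flat t , s
parseStep D (t , s)     = leaf , t ∷ s
parseStep U (a , b ∷ s) = arch a b , s
parseStep U (a , [])    = a , []

parse : Word → Tree × List Tree
parse = foldr parseStep (leaf , [])

parse-path-++ : ∀ t r {s} → parse r ≡ (leaf , s) → parse (path t ++ r) ≡ (t , s)
parse-path-++ leaf       r e = e
parse-path-++ (flat t)   r e = cong (parseStep F) (parse-path-++ t r e)
parse-path-++ (arch a b) r e = begin
  parseStep U (parse ((path a ++ D ∷ path b) ++ r)) ≡⟨ cong (parseStep U ∘ parse) (++-assoc (path a) (D ∷ path b) r) ⟩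
  parseStep U (parse (path a ++ D ∷ path b ++ r))   ≡⟨ cong (parseStep U) (parse-path-++ a _ (cong (parseStep D) (parse-path-++ b r e))) ⟩
  (arch a b , _)                                     ∎

parse-path : ∀ t → parse (path t) ≡ (t , [])
parse-path t = trans (cong parse (sym (++-identityʳ (path t)))) (parse-path-++ t [] refl)

startsWithU : Word → ℕ
startsWithU (U ∷ _) = 1
startsWithU _       = 0

startsWithU-++-D : ∀ xs ys → startsWithU (xs ++ D ∷ ys) ≡ startsWithU xs
startsWithU-++-D []      ys = refl
startsWithU-++-D (U ∷ _) ys = refl
startsWithU-++-D (F ∷ _) ys = refl
startsWithU-++-D (D ∷ _) ys = refl

countUU-U∷ : ∀ w → countUU (U ∷ w) ≡ startsWithU w + countUU w
countUU-U∷ []      = refl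
countUU-U∷ (U ∷ _) = refl
countUU-U∷ (F ∷ _) = refl
countUU-U∷ (D ∷ _) = refl

countUU-++-D : ∀ xs ys → countUU (xs ++ D ∷ ys) ≡ countUU xs + countUU ys
countUU-++-D []           ys = refl
countUU-++-D (U ∷ [])     ys = refl
countUU-++-D (U ∷ U ∷ xs) ys = cong suc (countUU-++-D (U ∷ xs) ys)
countUU-++-D (U ∷ F ∷ xs) ys = countUU-++-D xs ys
countUU-++-D (U ∷ D ∷ xs) ys = countUU-++-D xs ys
countUU-++-D (F ∷ xs)     ys = countUU-++-D xs ys
countUU-++-D (D ∷ xs)     ys = countUU-++-D xs ys

countDU-++-D : ∀ xs ys → countDU (xs ++ D ∷ ys) ≡ countDU xs + (startsWithU ys + countDU ys)
countDU-++-D []           []      = refl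
countDU-++-D []           (U ∷ _) = refl
countDU-++-D []           (F ∷ _) = refl
countDU-++-D []           (D ∷ _) = refl
countDU-++-D (D ∷ [])     ys      = countDU-++-D [] ys
countDU-++-D (D ∷ U ∷ xs) ys      = cong suc (countDU-++-D (U ∷ xs) ys)
countDU-++-D (D ∷ F ∷ xs) ys      = countDU-++-D xs ys
countDU-++-D (D ∷ D ∷ xs) ys      = countDU-++-D (D ∷ xs) ys
countDU-++-D (U ∷ xs)     ys      = countDU-++-D xs ys
countDU-++-D (F ∷ xs)     ys      = countDU-++-D xs ys

startsWithU-path-mirror : ∀ t → startsWithU (path (mirror t)) ≡ startsWithU (path t)
startsWithU-path-mirror leaf       = refl
startsWithU-path-mirror (flat _)   = refl
startsWithU-path-mirror (arch _ _) = refl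

countUU-path-mirror : ∀ t → countUU (path (mirror t)) ≡ countDU (path t)
countUU-path-mirror leaf       = refl
countUU-path-mirror (flat t)   = countUU-path-mirror t
countUU-path-mirror (arch a b) = begin
  countUU (U ∷ b′ ++ D ∷ a′)                                   ≡⟨ countUU-U∷ (b′ ++ D ∷ a′) ⟩
  startsWithU (b′ ++ D ∷ a′) + countUU (b′ ++ D ∷ a′)          ≡⟨ cong₂ _+_ (startsWithU-++-D b′ a′) (countUU-++-D b′ a′) ⟩
  startsWithU b′ + (countUU b′ + countUU a′)                   ≡⟨ cong₂ (λ x y → x + (y + countUU a′)) (startsWithU-path-mirror b) (countUU-path-mirror b) ⟩
  startsWithU (path b) + (countDU (path b) + countUU a′)       ≡⟨ +-assoc (startsWithU (path b)) _ _ ⟨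
  startsWithU (path b) + countDU (path b) + countUU a′         ≡⟨ +-comm _ (countUU a′) ⟩
  countUU a′ + (startsWithU (path b) + countDU (path b))       ≡⟨ cong (_+ _) (countUU-path-mirror a) ⟩
  countDU (path a) + (startsWithU (path b) + countDU (path b)) ≡⟨ countDU-++-D (path a) (path b) ⟨
  countDU (U ∷ path a ++ D ∷ path b)                           ∎
  where
  a′ b′ : Word
  a′ = path (mirror a)
  b′ = path (mirror b)

mirrorWord : Word → Word
mirrorWord w = if isMotzkin w then path (mirror (proj₁ (parse w))) else w

mirrorWord-path : ∀ t → mirrorWord (path t) ≡ path (mirror t)
mirrorWord-path t rewrite isMotzkin-path t | parse-path t = refl

mirrorWord-nonMotzkin : ∀ w → isMotzkin w ≡ false → mirrorWord w ≡ w
mirrorWord-nonMotzkin w m rewrite m = refl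

mirrorWord-involutive : ∀ w → mirrorWord (mirrorWord w) ≡ w
mirrorWord-involutive w with motzkinView w
... | motzkin t = begin
  mirrorWord (mirrorWord (path t))  ≡⟨ cong mirrorWord (mirrorWord-path t) ⟩
  mirrorWord (path (mirror t))      ≡⟨ mirrorWord-path (mirror t) ⟩
  path (mirror (mirror t))          ≡⟨ cong path (mirror-involutive t) ⟩
  path t                            ∎
... | nonMotzkin m = trans (cong mirrorWord (mirrorWord-nonMotzkin w m)) (mirrorWord-nonMotzkin w m)

length-mirrorWord : ∀ w → length (mirrorWord w) ≡ length w
length-mirrorWord w with motzkinView w
... | motzkin t    = trans (cong length (mirrorWord-path t)) (↭-length (path-mirror-↭ t))
... | nonMotzkin m = cong length (mirrorWord-nonMotzkin w m)

isMotzkin-mirrorWord : ∀ w → isMotzkin (mirrorWord w) ≡ isMotzkin w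
isMotzkin-mirrorWord w with motzkinView w
... | motzkin t    = trans (cong isMotzkin (mirrorWord-path t)) (trans (isMotzkin-path (mirror t)) (sym (isMotzkin-path t)))
... | nonMotzkin m = cong isMotzkin (mirrorWord-nonMotzkin w m)

countUU-mirrorWord : ∀ w → isMotzkin w ≡ true → countUU (mirrorWord w) ≡ countDU w
countUU-mirrorWord w m with motzkinView w
... | motzkin t     = trans (cong countUU (mirrorWord-path t)) (countUU-path-mirror t)
... | nonMotzkin m′ with () ← trans (sym m) m′

map-mirrorWord-words : ∀ n → map mirrorWord (words n) ↭ words n
map-mirrorWord-words n = ↭-of-multiplicities (map mirrorWord (words n)) (words n) λ w → begin
  multiplicity w (map mirrorWord (words n))  ≡⟨ multiplicity-map-involutive mirrorWord mirrorWord-involutive w (words n) ⟩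
  multiplicity (mirrorWord w) (words n)      ≡⟨ multiplicity-words n (length-mirrorWord w) ⟩
  multiplicity w (words n)                   ∎

MotzkinWith : (Word → ℕ) → ℕ → Pred Word 0ℓ
MotzkinWith count k w = isMotzkin w ≡ true × count w ≡ k

motzkinWith? : ∀ count k → Decidable (MotzkinWith count k)
motzkinWith? count k = (λ w → isMotzkin w Bool.≟ true) ∩? (λ w → count w ℕ.≟ k)

mirrorWord-exchanges : ∀ k → MotzkinWith countUU k ∘ mirrorWord ≐ MotzkinWith countDU k
mirrorWord-exchanges k =
    (λ {w} (m , c) → let m′ = trans (sym (isMotzkin-mirrorWord w)) m in m′ , trans (sym (countUU-mirrorWord w m′)) c)
  , (λ {w} (m , c) → trans (isMotzkin-mirrorWord w) m , trans (countUU-mirrorWord w m) c)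

numUU≡numDU : ∀ n k → numUU n k ≡ numDU n k
numUU≡numDU n k = begin
  numUU n k                                                          ≡⟨ cong length (filter-filter _ _ (words n)) ⟩
  length (filter (motzkinWith? countUU k) (words n))                 ≡⟨ length-filter-∘ _ mirrorWord (words n) (map-mirrorWord-words n) ⟩
  length (filter (motzkinWith? countUU k ∘ mirrorWord) (words n))    ≡⟨ cong length (filter-≐ _ _ (mirrorWord-exchanges k) (words n)) ⟩
  length (filter (motzkinWith? countDU k) (words n))                 ≡⟨ cong length (filter-filter _ _ (words n)) ⟨
  numDU n k                                                          ∎

mainTheorem1 : ((n k : ℕ) → numUU n k ≡ numDU n k) × ((n : ℕ) → avoidUU n ≡ avoidDU n)
mainTheorem1 = numUU≡numDU , λ n → numUU≡numDU n 0
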